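{- For any microCCS terms $M,N$ (possibly containing variables), $M$ and $N$ are extensionally equal if and only if $M=N$ is derivable in equational logic from $\mathcal D$.
   Context: Fix an infinite set of names. MicroCCS processes: $\eta ::= a\mid\overline a$, $P::=\mathbf 0\mid \eta.P\mid P|Q$, with transitions $\eta.P\xrightarrow{\eta}P$; if $P\xrightarrow{\eta}P'$, $Q\xrightarrow{\overline\eta}Q'$ then $P|Q\xrightarrow{\tau}P'|Q'$; if $P\xrightarrow{\mu}P'$ then $P|Q\xrightarrow{\mu}P'|Q$ and $Q|P\xrightarrow{\mu}Q|P'$. Strong bisimilarity $\sim$ is the union of all symmetric relations $\mathcal R$ such that $P\mathcal RQ$, $P\xrightarrow{\mu}P'$ imply $Q\xrightarrow{\mu}Q'$ with $P'\mathcal RQ'$. Terms with variables: $M::=\mathbf 0\mid\eta.M\mid M|M\mid X$. $M$ and $N$ are extensionally equal if for every ground instantiation $\rho$ (mapping all variables to variable-free terms) $M\rho\sim N\rho$. $\mathcal D$ consists of $X|Y=Y|X$, $X|(Y|Z)=(X|Y)|Z$, $X|\mathbf 0=X$, and for each $i\geq1$ and prefix $\eta$, $(D_i)\ \eta.(X|(\eta.X)^i)=(\eta.X)^{i+1}$, where $R^k$ is the $k$-fold parallel composition of $R$. Derivability is in equational logic. -}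

module Defs where

open import Data.Nat using (ℕ; zero; suc)
open import Data.Product using (Σ; _×_)

Name : Set
Name = ℕ

data Prefix : Set where
  inp : Name → Prefix
  out : Name → Prefix

co : Prefix → Prefix
co (inp a) = out a
co (out a) = inp a

data Act : Set where
  τ   : Act
  act : Prefix → Act

infixr 6 _∣_
data Proc : Set where
  𝟎   : Proc
  _·_ : Prefix → Proc → Proc
  _∣_ : Proc → Proc → Proc

data _─[_]→_ : Proc → Act → Proc → Set where
  pre  : ∀ {η P} → (η · P) ─[ act η ]→ P
  com  : ∀ {P P′ Q Q′ η} → P ─[ act η ]→ P′ → Q ─[ act (co η) ]→ Q′ →
         (P ∣ Q) ─[ τ ]→ (P′ ∣ Q′)
  parL : ∀ {P P′ Q μ} → P ─[ μ ]→ P′ → (P ∣ Q) ─[ μ ]→ (P′ ∣ Q)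
  parR : ∀ {P P′ Q μ} → P ─[ μ ]→ P′ → (Q ∣ P) ─[ μ ]→ (Q ∣ P′)

IsSymmetric : (Proc → Proc → Set) → Set
IsSymmetric R = ∀ {P Q} → R P Q → R Q P

IsSimulation : (Proc → Proc → Set) → Set
IsSimulation R = ∀ {P Q P′ μ} → R P Q → P ─[ μ ]→ P′ →
                 Σ Proc (λ Q′ → (Q ─[ μ ]→ Q′) × R P′ Q′)

_∼_ : Proc → Proc → Set₁
P ∼ Q = Σ (Proc → Proc → Set) (λ R → IsSymmetric R × IsSimulation R × R P Q)

infixr 6 _∥_
data Term : Set where
  𝟎ₜ  : Term
  _•_ : Prefix → Term → Term
  _∥_ : Term → Term → Term
  var : ℕ → Term

inst : (ℕ → Proc) → Term → Proc
inst ρ 𝟎ₜ      = 𝟎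
inst ρ (η • M) = η · inst ρ M
inst ρ (M ∥ N) = inst ρ M ∣ inst ρ N
inst ρ (var x) = ρ x

ExtEq : Term → Term → Set₁
ExtEq M N = ∀ (ρ : ℕ → Proc) → inst ρ M ∼ inst ρ N

subst : (ℕ → Term) → Term → Term
subst σ 𝟎ₜ      = 𝟎ₜ
subst σ (η • M) = η • subst σ M
subst σ (M ∥ N) = subst σ M ∥ subst σ N
subst σ (var x) = σ x

-- powS R k = R^(k+1) (right-nested k+1-fold parallel composition)
-- R^(suc k): R^1 = R, R^(k+2) = R | R^(k+1)
powS : Term → ℕ → Term
powS R zero    = R
powS R (suc k) = R ∥ powS R k

X Y Z : Term
X = var 0
Y = var 1
Z = var 2

data Axiom : Term → Term → Set where
  comm  : Axiom (X ∥ Y) (Y ∥ X)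
  assoc : Axiom (X ∥ (Y ∥ Z)) ((X ∥ Y) ∥ Z)
  unit  : Axiom (X ∥ 𝟎ₜ) X
  -- (D_i) for i = suc j ≥ 1:  η.(X | (η.X)^i) = (η.X)^(i+1)
  D     : (j : ℕ) (η : Prefix) →
          Axiom (η • (X ∥ powS (η • X) j)) (powS (η • X) (suc j))

data _⊢_≈_ (Ax : Term → Term → Set) : Term → Term → Set where
  ax    : ∀ {L R} (σ : ℕ → Term) → Ax L R → Ax ⊢ subst σ L ≈ subst σ R
  refl  : ∀ {M} → Ax ⊢ M ≈ M
  sym   : ∀ {M N} → Ax ⊢ M ≈ N → Ax ⊢ N ≈ M
  trans : ∀ {M N K} → Ax ⊢ M ≈ N → Ax ⊢ N ≈ K → Ax ⊢ M ≈ K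
  cpre  : ∀ {M N} (η : Prefix) → Ax ⊢ M ≈ N → Ax ⊢ (η • M) ≈ (η • N)
  cpar  : ∀ {M M′ N N′} → Ax ⊢ M ≈ M′ → Ax ⊢ N ≈ N′ → Ax ⊢ (M ∥ N) ≈ (M′ ∥ N′)

{-# OPTIONS --safe #-}
module Submission where

-- Soundness: derivable equality is closed under substitution and matches transitions step by
-- step on open terms (where a variable x has a transition of its own), so it relates ground
-- instances bisimilarly.
--
-- Completeness: instantiating each variable x by inp(K+x).𝟎, with K above every name of M and N,
-- turns a ground bisimulation into a bisimulation ≃ for the observable steps of the open terms.
-- By induction on size: every term is derivably equal to a product of normal components
-- (variables, and prefixes η.Π K with K normal and not of the shape rewritten by any (D_i));
-- two such products are ≃ only if they have the same components up to ≃ (unique decomposition: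
-- match the moves of a largest component, then cancel it); and ≃ components are derivably equal.

open import Defs
open import Algebra.Bundles using (CommutativeMonoid)
import Algebra.Properties.CommutativeSemigroup as CommutativeSemigroupProperties
open import Data.Empty using (⊥; ⊥-elim)
open import Data.List using (List; []; _∷_; [_]; _++_; foldr; map; length; filter; replicate)
open import Data.List.Properties
  using (length-++; filter-++; filter-accept; filter-reject; filter-none; filter-some)
open import Data.List.Membership.Propositional using (_∈_; find; lose)
open import Data.List.Membership.Propositional.Properties
  using (∈-map⁺; ∈-++⁺ˡ; ∈-++⁺ʳ; ∈-∃++; ∈-filter⁻)
open import Data.List.Relation.Binary.Permutation.Propositional
  using (_↭_; ↭-refl; ↭-sym; ↭-trans; ↭-prep; ↭-swap; ↭⇒↭ₛ′)
open import Data.List.Relation.Binary.Permutation.Propositional.Properties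
  using (shift; ++⁺ˡ; ↭-length; filter-↭; All-resp-↭)
import Data.List.Relation.Binary.Permutation.Setoid.Properties as PermutationProperties
open import Data.List.Relation.Unary.All as All using (All; []; _∷_; all?)
open import Data.List.Relation.Unary.All.Properties using (++⁺; replicate⁺)
open import Data.List.Relation.Unary.Any using (Any; here; there; any?)
open import Data.Nat using (ℕ; zero; suc; _+_; _⊔_; _<_; _≤_; s≤s; z≤n)
import Data.Nat.Properties as ℕ
open import Data.Product using (_,_; _×_; ∃; ∃₂; Σ; proj₁; proj₂; uncurry)
open import Data.Sum using (_⊎_; inj₁; inj₂)
open import Data.Unit using (⊤; tt)
open import Function using (_∘_; flip)
open import Relation.Binary.Bundles using (Setoid)
open import Relation.Binary.Definitions using (DecidableEquality)
open import Relation.Binary.PropositionalEquality as ≡ using (_≡_; cong; cong₂)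
import Relation.Binary.Reasoning.Setoid as SetoidReasoning
open import Relation.Nullary using (Dec; yes; no; ¬_)
open import Relation.Nullary.Decidable using (map′; _×-dec_)

infix 4 _≈ᴰ_
_≈ᴰ_ : Term → Term → Set
M ≈ᴰ N = Axiom ⊢ M ≈ N

⟦_,_,_⟧ : Term → Term → Term → ℕ → Term
⟦ A , B , C ⟧ 0 = A
⟦ A , B , C ⟧ 1 = B
⟦ A , B , C ⟧ 2 = C
⟦ A , B , C ⟧ (suc (suc (suc _))) = 𝟎ₜ

∥-comm : ∀ A B → A ∥ B ≈ᴰ B ∥ A
∥-comm A B = ax ⟦ A , B , 𝟎ₜ ⟧ comm

∥-assoc : ∀ A B C → (A ∥ B) ∥ C ≈ᴰ A ∥ (B ∥ C)
∥-assoc A B C = sym (ax ⟦ A , B , C ⟧ assoc)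

∥-identityʳ : ∀ A → A ∥ 𝟎ₜ ≈ᴰ A
∥-identityʳ A = ax ⟦ A , 𝟎ₜ , 𝟎ₜ ⟧ unit

∥-identityˡ : ∀ A → 𝟎ₜ ∥ A ≈ᴰ A
∥-identityˡ A = trans (∥-comm 𝟎ₜ A) (∥-identityʳ A)

∥-commutativeMonoid : CommutativeMonoid _ _
∥-commutativeMonoid = record
  { Carrier = Term ; _≈_ = _≈ᴰ_ ; _∙_ = _∥_ ; ε = 𝟎ₜ
  ; isCommutativeMonoid = record
    { isMonoid = record
      { isSemigroup = record
        { isMagma = record
          { isEquivalence = record { refl = refl ; sym = sym ; trans = trans }
          ; ∙-cong = cpar }
        ; assoc = ∥-assoc }
      ; identity = ∥-identityˡ , ∥-identityʳ }
    ; comm = ∥-comm } }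

open CommutativeMonoid ∥-commutativeMonoid
  using (isCommutativeMonoid; isEquivalence; commutativeSemigroup) renaming (setoid to ≈ᴰ-setoid)
open CommutativeSemigroupProperties commutativeSemigroup using (x∙yz≈y∙xz)
module ≈ᴰ-Reasoning = SetoidReasoning ≈ᴰ-setoid

Π : List Term → Term
Π = foldr _∥_ 𝟎ₜ

Π-++ : ∀ L L′ → Π (L ++ L′) ≈ᴰ Π L ∥ Π L′
Π-++ []      L′ = sym (∥-identityˡ (Π L′))
Π-++ (c ∷ L) L′ = trans (cpar refl (Π-++ L L′)) (sym (∥-assoc c (Π L) (Π L′)))

Π-↭ : ∀ {L L′} → L ↭ L′ → Π L ≈ᴰ Π L′
Π-↭ L↭L′ =
  PermutationProperties.foldr-commMonoid ≈ᴰ-setoid isCommutativeMonoid (↭⇒↭ₛ′ isEquivalence L↭L′)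

subst-powS : ∀ σ R j → subst σ (powS R j) ≡ powS (subst σ R) j
subst-powS σ R zero    = ≡.refl
subst-powS σ R (suc j) = cong (subst σ R ∥_) (subst-powS σ R j)

D-law : ∀ j η A → η • (A ∥ powS (η • A) j) ≈ᴰ powS (η • A) (suc j)
D-law j η A = ≡.subst₂ (λ P Q → η • (A ∥ P) ≈ᴰ Q)
  (subst-powS σ (η • X) j) (subst-powS σ (η • X) (suc j)) (ax σ (D j η))
  where σ = ⟦ A , 𝟎ₜ , 𝟎ₜ ⟧

subst-subst : ∀ θ σ M → subst θ (subst σ M) ≡ subst (subst θ ∘ σ) M
subst-subst θ σ 𝟎ₜ      = ≡.refl
subst-subst θ σ (η • M) = cong (η •_) (subst-subst θ σ M)
subst-subst θ σ (M ∥ N) = cong₂ _∥_ (subst-subst θ σ M) (subst-subst θ σ N)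
subst-subst θ σ (var x) = ≡.refl

subst-≈ᴰ : ∀ θ {M N} → M ≈ᴰ N → subst θ M ≈ᴰ subst θ N
subst-≈ᴰ θ (ax {L} {R} σ a) =
  ≡.subst₂ _≈ᴰ_ (≡.sym (subst-subst θ σ L)) (≡.sym (subst-subst θ σ R)) (ax (subst θ ∘ σ) a)
subst-≈ᴰ θ refl        = refl
subst-≈ᴰ θ (sym d)     = sym (subst-≈ᴰ θ d)
subst-≈ᴰ θ (trans d e) = trans (subst-≈ᴰ θ d) (subst-≈ᴰ θ e)
subst-≈ᴰ θ (cpre η d)  = cpre η (subst-≈ᴰ θ d)
subst-≈ᴰ θ (cpar d e)  = cpar (subst-≈ᴰ θ d) (subst-≈ᴰ θ e)

-- Open terms as a transition system

data Obs : Set where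
  preᵒ : Prefix → Obs
  varᵒ : ℕ → Obs

data Label : Set where
  τₗ  : Label
  obs : Obs → Label

infix 4 _⟶[_]_
data _⟶[_]_ : Term → Label → Term → Set where
  preₜ  : ∀ {η M} → η • M ⟶[ obs (preᵒ η) ] M
  varₜ  : ∀ {x} → var x ⟶[ obs (varᵒ x) ] 𝟎ₜ
  comₜ  : ∀ {M M′ N N′ η} → M ⟶[ obs (preᵒ η) ] M′ → N ⟶[ obs (preᵒ (co η)) ] N′ →
          M ∥ N ⟶[ τₗ ] M′ ∥ N′
  parLₜ : ∀ {M M′ N l} → M ⟶[ l ] M′ → M ∥ N ⟶[ l ] M′ ∥ N
  parRₜ : ∀ {M N N′ l} → N ⟶[ l ] N′ → M ∥ N ⟶[ l ] M ∥ N′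

size : Term → ℕ
size 𝟎ₜ      = 0
size (η • M) = suc (size M)
size (M ∥ N) = size M + size N
size (var x) = 1

size-step : ∀ {M o M′} → M ⟶[ obs o ] M′ → size M ≡ suc (size M′)
size-step preₜ = ≡.refl
size-step varₜ = ≡.refl
size-step (parLₜ {N = N} t) = cong (_+ size N) (size-step t)
size-step (parRₜ {M = M} {N′ = N′} t) =
  ≡.trans (cong (size M +_) (size-step t)) (ℕ.+-suc (size M) (size N′))

size-step-< : ∀ {M o M′} → M ⟶[ obs o ] M′ → size M′ < size M
size-step-< t = ℕ.≤-reflexive (≡.sym (size-step t))

Step : Term → Set
Step M = ∃₂ λ o M′ → M ⟶[ obs o ] M′

step-or-size≡0 : ∀ M → Step M ⊎ size M ≡ 0
step-or-size≡0 𝟎ₜ      = inj₂ ≡.refl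
step-or-size≡0 (η • M) = inj₁ (_ , _ , preₜ)
step-or-size≡0 (var x) = inj₁ (_ , _ , varₜ)
step-or-size≡0 (M ∥ N) with step-or-size≡0 M | step-or-size≡0 N
... | inj₁ (_ , _ , t) | _                = inj₁ (_ , _ , parLₜ t)
... | inj₂ _           | inj₁ (_ , _ , t) = inj₁ (_ , _ , parRₜ t)
... | inj₂ M≡0         | inj₂ N≡0         = inj₂ (cong₂ _+_ M≡0 N≡0)

step-bound : ∀ {n M o M′} → M ⟶[ obs o ] M′ → size M < suc n → size M′ < n
step-bound t M<1+n = ℕ.<-≤-trans (size-step-< t) (ℕ.≤-pred M<1+n)

co-involutive : ∀ η → co (co η) ≡ η
co-involutive (inp a) = ≡.refl
co-involutive (out a) = ≡.refl

infix 4 _≲_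
_≲_ : Term → Term → Set
M ≲ N = ∀ {l M′} → M ⟶[ l ] M′ → ∃ λ N′ → N ⟶[ l ] N′ × M′ ≈ᴰ N′

∥-comm-≲ : ∀ A B → A ∥ B ≲ B ∥ A
∥-comm-≲ A B (parLₜ t) = _ , parRₜ t , ∥-comm _ _
∥-comm-≲ A B (parRₜ t) = _ , parLₜ t , ∥-comm _ _
∥-comm-≲ A B (comₜ {η = η} t u) =
  _ , comₜ u (≡.subst (λ η′ → A ⟶[ obs (preᵒ η′) ] _) (≡.sym (co-involutive η)) t) , ∥-comm _ _

∥-assoc-≲ : ∀ A B C → (A ∥ B) ∥ C ≲ A ∥ (B ∥ C)
∥-assoc-≲ A B C (parLₜ (parLₜ t))   = _ , parLₜ t , ∥-assoc _ _ _
∥-assoc-≲ A B C (parLₜ (parRₜ t))   = _ , parRₜ (parLₜ t) , ∥-assoc _ _ _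
∥-assoc-≲ A B C (parLₜ (comₜ t u))  = _ , comₜ t (parLₜ u) , ∥-assoc _ _ _
∥-assoc-≲ A B C (parRₜ t)           = _ , parRₜ (parRₜ t) , ∥-assoc _ _ _
∥-assoc-≲ A B C (comₜ (parLₜ t) u)  = _ , comₜ t (parRₜ u) , ∥-assoc _ _ _
∥-assoc-≲ A B C (comₜ (parRₜ t) u)  = _ , parRₜ (comₜ t u) , ∥-assoc _ _ _

∥-assoc-≳ : ∀ A B C → A ∥ (B ∥ C) ≲ (A ∥ B) ∥ C
∥-assoc-≳ A B C (parLₜ t)           = _ , parLₜ (parLₜ t) , sym (∥-assoc _ _ _)
∥-assoc-≳ A B C (parRₜ (parLₜ t))   = _ , parLₜ (parRₜ t) , sym (∥-assoc _ _ _)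
∥-assoc-≳ A B C (parRₜ (parRₜ t))   = _ , parRₜ t , sym (∥-assoc _ _ _)
∥-assoc-≳ A B C (parRₜ (comₜ t u))  = _ , comₜ (parRₜ t) u , sym (∥-assoc _ _ _)
∥-assoc-≳ A B C (comₜ t (parLₜ u))  = _ , parLₜ (comₜ t u) , sym (∥-assoc _ _ _)
∥-assoc-≳ A B C (comₜ t (parRₜ u))  = _ , comₜ (parLₜ t) u , sym (∥-assoc _ _ _)

∥-identityʳ-≲ : ∀ A → A ∥ 𝟎ₜ ≲ A
∥-identityʳ-≲ A (parLₜ t) = _ , t , ∥-identityʳ _

∥-identityʳ-≳ : ∀ A → A ≲ A ∥ 𝟎ₜ
∥-identityʳ-≳ A t = _ , parLₜ t , sym (∥-identityʳ _)

powS-step : ∀ {η A j l Y} → powS (η • A) j ⟶[ l ] Y →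
            l ≡ obs (preᵒ η) × A ∥ powS (η • A) j ≈ᴰ (η • A) ∥ Y
powS-step {j = zero}  preₜ         = ≡.refl , ∥-comm _ _
powS-step {j = suc j} (parLₜ preₜ) = ≡.refl , x∙yz≈y∙xz _ _ _
powS-step {j = suc j} (parRₜ t)    =
  let l≡η , d = powS-step t in l≡η , trans (x∙yz≈y∙xz _ _ _) (cpar refl d)
powS-step {η = inp a} {j = suc j} (comₜ preₜ u) with () ← proj₁ (powS-step u)
powS-step {η = out a} {j = suc j} (comₜ preₜ u) with () ← proj₁ (powS-step u)

D-≲ : ∀ j η A → η • (A ∥ powS (η • A) j) ≲ powS (η • A) (suc j)
D-≲ j η A preₜ = _ , parLₜ preₜ , refl

D-≳ : ∀ j η A → powS (η • A) (suc j) ≲ η • (A ∥ powS (η • A) j)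
D-≳ j η A (parLₜ preₜ) = _ , preₜ , refl
D-≳ j η A (parRₜ t) with ≡.refl , d ← powS-step t = _ , preₜ , sym d
D-≳ j (inp a) A (comₜ preₜ u) with () ← proj₁ (powS-step u)
D-≳ j (out a) A (comₜ preₜ u) with () ← proj₁ (powS-step u)

≲-refl : ∀ {M} → M ≲ M
≲-refl t = _ , t , refl

≲-trans : ∀ {A B C} → A ≲ B → B ≲ C → A ≲ C
≲-trans A≲B B≲C t =
  let _ , u , d = A≲B t
      _ , v , e = B≲C u
  in _ , v , trans d e

•-mono-≲ : ∀ {η A A′} → A ≈ᴰ A′ → η • A ≲ η • A′
•-mono-≲ d preₜ = _ , preₜ , d

∥-mono-≲ : ∀ {A A′ B B′} → A ≈ᴰ A′ → B ≈ᴰ B′ → A ≲ A′ → B ≲ B′ →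
           A ∥ B ≲ A′ ∥ B′
∥-mono-≲ _ B≈B′ A≲A′ _ (parLₜ t) = let _ , u , d = A≲A′ t in _ , parLₜ u , cpar d B≈B′
∥-mono-≲ A≈A′ _ _ B≲B′ (parRₜ t) = let _ , u , d = B≲B′ t in _ , parRₜ u , cpar A≈A′ d
∥-mono-≲ _ _ A≲A′ B≲B′ (comₜ t t′) =
  let _ , u , d = A≲A′ t
      _ , u′ , d′ = B≲B′ t′
  in _ , comₜ u u′ , cpar d d′

≈ᴰ⇒≲ : ∀ {M N} → M ≈ᴰ N → M ≲ N × N ≲ M
≈ᴰ⇒≲ (ax σ comm)  = ∥-comm-≲ _ _ , ∥-comm-≲ _ _
≈ᴰ⇒≲ (ax σ assoc) = ∥-assoc-≳ _ _ _ , ∥-assoc-≲ _ _ _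
≈ᴰ⇒≲ (ax σ unit)  = ∥-identityʳ-≲ _ , ∥-identityʳ-≳ _
≈ᴰ⇒≲ (ax σ (D j η)) rewrite subst-powS σ (η • X) j = D-≲ j η (σ 0) , D-≳ j η (σ 0)
≈ᴰ⇒≲ refl         = ≲-refl , ≲-refl
≈ᴰ⇒≲ (sym d)      = let M≲N , N≲M = ≈ᴰ⇒≲ d in N≲M , M≲N
≈ᴰ⇒≲ (trans d e)  =
  let M≲N , N≲M = ≈ᴰ⇒≲ d
      N≲K , K≲N = ≈ᴰ⇒≲ e
  in ≲-trans M≲N N≲K , ≲-trans K≲N N≲M
≈ᴰ⇒≲ (cpre η d)   = •-mono-≲ d , •-mono-≲ (sym d)
≈ᴰ⇒≲ (cpar d e)   =
  let A≲A′ , A′≲A = ≈ᴰ⇒≲ d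
      B≲B′ , B′≲B = ≈ᴰ⇒≲ e
  in ∥-mono-≲ d e A≲A′ B≲B′ , ∥-mono-≲ (sym d) (sym e) A′≲A B′≲B

-- Soundness

embed : Proc → Term
embed 𝟎       = 𝟎ₜ
embed (η · P) = η • embed P
embed (P ∣ Q) = embed P ∥ embed Q

embed-inst : ∀ ρ M → embed (inst ρ M) ≡ subst (embed ∘ ρ) M
embed-inst ρ 𝟎ₜ      = ≡.refl
embed-inst ρ (η • M) = cong (η •_) (embed-inst ρ M)
embed-inst ρ (M ∥ N) = cong₂ _∥_ (embed-inst ρ M) (embed-inst ρ N)
embed-inst ρ (var x) = ≡.refl

actLabel : Act → Label
actLabel τ       = τₗ
actLabel (act η) = obs (preᵒ η)

embed-step : ∀ {P μ P′} → P ─[ μ ]→ P′ → embed P ⟶[ actLabel μ ] embed P′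
embed-step pre       = preₜ
embed-step (com s r) = comₜ (embed-step s) (embed-step r)
embed-step (parL s)  = parLₜ (embed-step s)
embed-step (parR s)  = parRₜ (embed-step s)

embed-step⁻ : ∀ P {μ l T} → embed P ⟶[ l ] T → l ≡ actLabel μ →
              ∃ λ P′ → T ≡ embed P′ × P ─[ μ ]→ P′
embed-step⁻ (η · P) {act .η} preₜ ≡.refl = P , ≡.refl , pre
embed-step⁻ (η · P) {τ}      preₜ ()
embed-step⁻ (P ∣ Q) (parLₜ t) l≡μ with P′ , ≡.refl , s ← embed-step⁻ P t l≡μ =
  P′ ∣ Q , ≡.refl , parL s
embed-step⁻ (P ∣ Q) (parRₜ t) l≡μ with Q′ , ≡.refl , s ← embed-step⁻ Q t l≡μ =
  P ∣ Q′ , ≡.refl , parR s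
embed-step⁻ (P ∣ Q) {act _} (comₜ t u) ()
embed-step⁻ (P ∣ Q) {τ}     (comₜ t u) ≡.refl
  with P′ , ≡.refl , s ← embed-step⁻ P {act _} t ≡.refl
  with Q′ , ≡.refl , r ← embed-step⁻ Q {act _} u ≡.refl = P′ ∣ Q′ , ≡.refl , com s r

soundness : ∀ {M N} → M ≈ᴰ N → ExtEq M N
soundness {M} {N} M≈N ρ = Derivable , sym , simulation ,
  ≡.subst₂ _≈ᴰ_ (≡.sym (embed-inst ρ M)) (≡.sym (embed-inst ρ N)) (subst-≈ᴰ (embed ∘ ρ) M≈N)
  where
  Derivable : Proc → Proc → Set
  Derivable P Q = embed P ≈ᴰ embed Q
  simulation : IsSimulation Derivable
  simulation {Q = Q} P≈Q s
    with _ , t , d ← proj₁ (≈ᴰ⇒≲ P≈Q) (embed-step s)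
    with Q′ , ≡.refl , r ← embed-step⁻ Q t ≡.refl = Q′ , r , d

-- Observable bisimilarity

Transfer : (Term → Term → Set) → Term → Term → Set
Transfer R M N = ∀ {o M′} → M ⟶[ obs o ] M′ → ∃ λ N′ → N ⟶[ obs o ] N′ × R M′ N′

-- Observable steps decrease size, so the inductive definition is already bisimilarity.
infix 4 _≃_
data _≃_ (M N : Term) : Set where
  bisim : Transfer _≃_ M N → Transfer (flip _≃_) N M → M ≃ N

≃-transfer : ∀ {M N} → M ≃ N → Transfer _≃_ M N
≃-transfer (bisim f _) = f

≃-transfer⁻ : ∀ {M N} → M ≃ N → Transfer (flip _≃_) N M
≃-transfer⁻ (bisim _ b) = b

𝟎-≃ : 𝟎ₜ ≃ 𝟎ₜ
𝟎-≃ = bisim (λ ()) (λ ())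

≃-• : ∀ {η A A′} → A ≃ A′ → η • A ≃ η • A′
≃-• A≃A′ = bisim (λ { preₜ → _ , preₜ , A≃A′ }) (λ { preₜ → _ , preₜ , A≃A′ })

-- ≃-∥ is split in two so that the termination checker sees the lexicographic descent.
mutual
  ≃-∥ : ∀ {A A′ B B′} → A ≃ A′ → B ≃ B′ → A ∥ B ≃ A′ ∥ B′
  ≃-∥ (bisim fA bA) = ≃-∥′ fA bA

  ≃-∥′ : ∀ {A A′ B B′} → Transfer _≃_ A A′ → Transfer (flip _≃_) A′ A → B ≃ B′ →
         A ∥ B ≃ A′ ∥ B′
  ≃-∥′ fA bA B≃B′@(bisim fB bB) = bisim fw bw
    where
    fw : Transfer _≃_ _ _
    fw (parLₜ t) with fA t
    ... | _ , u , r = _ , parLₜ u , ≃-∥ r B≃B′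
    fw (parRₜ t) with fB t
    ... | _ , u , r = _ , parRₜ u , ≃-∥′ fA bA r
    bw : Transfer (flip _≃_) _ _
    bw (parLₜ t) with bA t
    ... | _ , u , r = _ , parLₜ u , ≃-∥ r B≃B′
    bw (parRₜ t) with bB t
    ... | _ , u , r = _ , parRₜ u , ≃-∥′ fA bA r

≃-refl : ∀ {M} → M ≃ M
≃-refl {𝟎ₜ}    = 𝟎-≃
≃-refl {η • M} = ≃-• ≃-refl
≃-refl {M ∥ N} = ≃-∥ ≃-refl ≃-refl
≃-refl {var x} = bisim (λ { varₜ → _ , varₜ , 𝟎-≃ }) (λ { varₜ → _ , varₜ , 𝟎-≃ })

≃-sym : ∀ {M N} → M ≃ N → N ≃ M
≃-sym (bisim f b) = bisim (λ t → let _ , u , r = b t in _ , u , ≃-sym r)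
                          (λ t → let _ , u , r = f t in _ , u , ≃-sym r)

≃-trans : ∀ {A B C} → A ≃ B → B ≃ C → A ≃ C
≃-trans (bisim fAB bAB) (bisim fBC bBC) = bisim fw bw
  where
  fw : Transfer _≃_ _ _
  fw t with _ , u , r ← fAB t with _ , v , r′ ← fBC u = _ , v , ≃-trans r r′
  bw : Transfer (flip _≃_) _ _
  bw t with _ , u , r′ ← bBC t with _ , v , r ← bAB u = _ , v , ≃-trans r r′

≃-setoid : Setoid _ _
≃-setoid = record { Carrier = Term ; _≈_ = _≃_
                  ; isEquivalence = record { refl = ≃-refl ; sym = ≃-sym ; trans = ≃-trans } }

≃-size : ∀ {M N} → M ≃ N → size M ≡ size N
≃-size {M} {N} (bisim f b) with step-or-size≡0 M | step-or-size≡0 N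
... | inj₁ (_ , _ , t) | _ = let _ , u , r = f t in
  ≡.trans (size-step t) (≡.trans (cong suc (≃-size r)) (≡.sym (size-step u)))
... | inj₂ M≡0 | inj₂ N≡0 = ≡.trans M≡0 (≡.sym N≡0)
... | inj₂ M≡0 | inj₁ (_ , _ , u)
  with _ , t , _ ← b u with () ← ≡.trans (≡.sym M≡0) (size-step t)

UpTo≃ : (Term → Term → Set) → Term → Term → Set
UpTo≃ R M N = ∃₂ λ M₁ N₁ → M ≃ M₁ × R M₁ N₁ × N₁ ≃ N

upTo≃ : ∀ {R M N} → R M N → UpTo≃ R M N
upTo≃ r = _ , _ , ≃-refl , r , ≃-refl

UpTo≃-sym : ∀ {R} → (∀ {M N} → R M N → R N M) → ∀ {M N} → UpTo≃ R M N → UpTo≃ R N M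
UpTo≃-sym R-sym (_ , _ , M≃M₁ , r , N₁≃N) = _ , _ , ≃-sym N₁≃N , R-sym r , ≃-sym M≃M₁

Transfer-map : ∀ {R S M N} → (∀ {A B} → R A B → S A B) → Transfer R M N → Transfer S M N
Transfer-map R⇒S transfer t = let _ , u , r = transfer t in _ , u , R⇒S r

IsBisimulationUpTo≃ : (Term → Term → Set) → Set
IsBisimulationUpTo≃ R =
  ∀ {M N} → R M N → Transfer (UpTo≃ R) M N × Transfer (flip (UpTo≃ R)) N M

bisimulationUpTo≃⊆≃ : ∀ {R} → IsBisimulationUpTo≃ R → ∀ {M N} → R M N → M ≃ N
bisimulationUpTo≃⊆≃ {R} isBisim {M} = go (suc (size M)) (ℕ.n<1+n (size M))
  where
  go : ∀ n {M N} → size M < n → R M N → M ≃ N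
  go (suc n) {M} M<1+n r = bisim fw bw
    where
    close : ∀ {o M′ N′} → M ⟶[ obs o ] M′ → UpTo≃ R M′ N′ → M′ ≃ N′
    close t (_ , _ , M′≃M₁ , r₁ , N₁≃N′) = ≃-trans M′≃M₁ (≃-trans M₁≃N₁ N₁≃N′)
      where
      M₁≃N₁ = go n (≡.subst (_< n) (≃-size M′≃M₁) (step-bound t M<1+n)) r₁
    fw : Transfer _≃_ _ _
    fw t with _ , u , up ← proj₁ (isBisim r) t = _ , u , close t up
    bw : Transfer (flip _≃_) _ _
    bw u with _ , t , up ← proj₂ (isBisim r) u = _ , t , close t up

≈ᴰ⇒≃ : ∀ {M N} → M ≈ᴰ N → M ≃ N
≈ᴰ⇒≃ = bisimulationUpTo≃⊆≃ λ M≈N →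
  (λ t → let _ , u , d = proj₁ (≈ᴰ⇒≲ M≈N) t in _ , u , upTo≃ d) ,
  (λ u → let _ , t , d = proj₂ (≈ᴰ⇒≲ M≈N) u in _ , t , upTo≃ (sym d))

_≟ᵖ_ : DecidableEquality Prefix
inp a ≟ᵖ inp b = map′ (cong inp) (λ { ≡.refl → ≡.refl }) (a ℕ.≟ b)
out a ≟ᵖ out b = map′ (cong out) (λ { ≡.refl → ≡.refl }) (a ℕ.≟ b)
inp a ≟ᵖ out b = no λ ()
out a ≟ᵖ inp b = no λ ()

_≟ᵒ_ : DecidableEquality Obs
preᵒ η ≟ᵒ preᵒ η′ = map′ (cong preᵒ) (λ { ≡.refl → ≡.refl }) (η ≟ᵖ η′)
varᵒ x ≟ᵒ varᵒ y  = map′ (cong varᵒ) (λ { ≡.refl → ≡.refl }) (x ℕ.≟ y)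
preᵒ η ≟ᵒ varᵒ y  = no λ ()
varᵒ x ≟ᵒ preᵒ η′ = no λ ()

steps : (M : Term) → List (Step M)
steps 𝟎ₜ      = []
steps (η • M) = (_ , _ , preₜ) ∷ []
steps (var x) = (_ , _ , varₜ) ∷ []
steps (M ∥ N) = map (λ (o , M′ , t) → o , M′ ∥ N , parLₜ t) (steps M)
             ++ map (λ (o , N′ , t) → o , M ∥ N′ , parRₜ t) (steps N)

steps-complete : ∀ {M o M′} (t : M ⟶[ obs o ] M′) → (o , M′ , t) ∈ steps M
steps-complete preₜ = here ≡.refl
steps-complete varₜ = here ≡.refl
steps-complete (parLₜ t) = ∈-++⁺ˡ (∈-map⁺ _ (steps-complete t))
steps-complete {M ∥ _} (parRₜ t) = ∈-++⁺ʳ (map _ (steps M)) (∈-map⁺ _ (steps-complete t))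

Transfer-dec : ∀ {R M N} → (∀ ((_ , M′ , _) : Step M) ((_ , N′ , _) : Step N) → Dec (R M′ N′)) →
               Dec (Transfer R M N)
Transfer-dec {R} {M} {N} R? = map′ fromAll toAll
  (all? (λ s → any? (λ s′ → (proj₁ s ≟ᵒ proj₁ s′) ×-dec R? s s′) (steps N)) (steps M))
  where
  Matched : Step M → Set
  Matched (o , M′ , _) = Any (λ (o′ , N′ , _) → o ≡ o′ × R M′ N′) (steps N)
  fromAll : All Matched (steps M) → Transfer R M N
  fromAll matched t with (_ , N′ , u) , _ , ≡.refl , r ← find (All.lookup matched (steps-complete t)) =
    N′ , u , r
  toAll : Transfer R M N → All Matched (steps M)
  toAll transfer = All.tabulate λ { {_ , _ , t} _ →
    let _ , u , r = transfer t in lose (steps-complete u) (≡.refl , r) }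

≃-dec : ∀ M N → Dec (M ≃ N)
≃-dec M N = go (suc (size M)) M N (ℕ.n<1+n (size M))
  where
  go : ∀ n M N → size M < n → Dec (M ≃ N)
  go (suc n) M N M<1+n = map′ (uncurry bisim) (λ { (bisim f b) → f , b })
    (Transfer-dec (λ (_ , M′ , t) (_ , N′ , _) → go n M′ N′ (step-bound t M<1+n)) ×-dec
     Transfer-dec (λ (_ , N′ , _) (_ , M′ , t) → go n M′ N′ (step-bound t M<1+n)))

-- Fresh instantiation

name : Prefix → ℕ
name (inp a) = a
name (out a) = a

maxName : Term → ℕ
maxName 𝟎ₜ      = 0
maxName (η • M) = name η ⊔ maxName M
maxName (M ∥ N) = maxName M ⊔ maxName N
maxName (var x) = 0

fresh : ℕ → ℕ → Proc
fresh K x = inp (K + x) · 𝟎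

groundObs : ℕ → Obs → Prefix
groundObs K (preᵒ η) = η
groundObs K (varᵒ x) = inp (K + x)

ObsBelow : ℕ → Obs → Set
ObsBelow K (preᵒ η) = name η < K
ObsBelow K (varᵒ x) = ⊤

groundObs-injective : ∀ {K o o′} → ObsBelow K o → ObsBelow K o′ →
                      groundObs K o ≡ groundObs K o′ → o ≡ o′
groundObs-injective {o = preᵒ η} {preᵒ η′} _ _ η≡η′ = cong preᵒ η≡η′
groundObs-injective {K} {varᵒ x} {varᵒ y} _ _ e = cong varᵒ (ℕ.+-cancelˡ-≡ K x y (cong name e))
groundObs-injective {K} {preᵒ _} {varᵒ y} η<K _ e =
  ⊥-elim (ℕ.<⇒≱ η<K (≡.subst (K ≤_) (≡.sym (cong name e)) (ℕ.m≤m+n K y)))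
groundObs-injective {K} {varᵒ x} {preᵒ _} _ η<K e =
  ⊥-elim (ℕ.<⇒≱ η<K (≡.subst (K ≤_) (cong name e) (ℕ.m≤m+n K x)))

step-below : ∀ {K M o M′} → maxName M < K → M ⟶[ obs o ] M′ → ObsBelow K o × maxName M′ < K
step-below {M = η • M} M<K preₜ =
  ℕ.m⊔n<o⇒m<o (name η) (maxName M) M<K , ℕ.m⊔n<o⇒n<o (name η) (maxName M) M<K
step-below M<K varₜ = tt , M<K
step-below {M = M ∥ N} M∥N<K (parLₜ t) =
  let below , M′<K = step-below (ℕ.m⊔n<o⇒m<o (maxName M) (maxName N) M∥N<K) t
  in below , ℕ.⊔-lub M′<K (ℕ.m⊔n<o⇒n<o (maxName M) (maxName N) M∥N<K)
step-below {M = M ∥ N} M∥N<K (parRₜ t) =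
  let below , N′<K = step-below (ℕ.m⊔n<o⇒n<o (maxName M) (maxName N) M∥N<K) t
  in below , ℕ.⊔-lub (ℕ.m⊔n<o⇒m<o (maxName M) (maxName N) M∥N<K) N′<K

inst-step : ∀ {K M o M′} → M ⟶[ obs o ] M′ →
            inst (fresh K) M ─[ act (groundObs K o) ]→ inst (fresh K) M′
inst-step preₜ      = pre
inst-step varₜ      = pre
inst-step (parLₜ t) = parL (inst-step t)
inst-step (parRₜ t) = parR (inst-step t)

inst-step⁻ : ∀ {K} M {η Q′} → inst (fresh K) M ─[ act η ]→ Q′ →
             ∃₂ λ o M′ → M ⟶[ obs o ] M′ × groundObs K o ≡ η × Q′ ≡ inst (fresh K) M′
inst-step⁻ (η • M) pre = _ , _ , preₜ , ≡.refl , ≡.refl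
inst-step⁻ (var x) pre = _ , _ , varₜ , ≡.refl , ≡.refl
inst-step⁻ (M ∥ N) (parL s) with _ , _ , t , e , ≡.refl ← inst-step⁻ M s =
  _ , _ , parLₜ t , e , ≡.refl
inst-step⁻ (M ∥ N) (parR s) with _ , _ , t , e , ≡.refl ← inst-step⁻ N s =
  _ , _ , parRₜ t , e , ≡.refl

module _ (K : ℕ) {R : Proc → Proc → Set} (R-sym : IsSymmetric R) (R-simulation : IsSimulation R) where

  record FreshlyRelated (A B : Term) : Set where
    constructor related
    field
      A<K : maxName A < K
      B<K : maxName B < K
      instances : R (inst (fresh K) A) (inst (fresh K) B)

  freshlyRelated-sym : ∀ {A B} → FreshlyRelated A B → FreshlyRelated B A
  freshlyRelated-sym (related A<K B<K r) = related B<K A<K (R-sym r)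

  freshlyRelated-transfer : ∀ {A B} → FreshlyRelated A B → Transfer FreshlyRelated A B
  freshlyRelated-transfer {A} {B} (related A<K B<K r) t
    with _ , s , r′ ← R-simulation r (inst-step t)
    with _ , B′ , u , e , ≡.refl ← inst-step⁻ B s
    with below-t , A′<K ← step-below A<K t
    with below-u , B′<K ← step-below B<K u
    with ≡.refl ← groundObs-injective below-u below-t e = B′ , u , related A′<K B′<K r′

  freshlyRelated-isBisimulationUpTo≃ : IsBisimulationUpTo≃ FreshlyRelated
  freshlyRelated-isBisimulationUpTo≃ rel =
    Transfer-map (upTo≃ {FreshlyRelated}) (freshlyRelated-transfer rel) ,
    Transfer-map (upTo≃ {FreshlyRelated} ∘ freshlyRelated-sym)
                 (freshlyRelated-transfer (freshlyRelated-sym rel))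

extEq⇒≃ : ∀ {M N} → ExtEq M N → M ≃ N
extEq⇒≃ {M} {N} ext =
  let R , R-sym , R-simulation , r = ext (fresh K)
  in bisimulationUpTo≃⊆≃ (freshlyRelated-isBisimulationUpTo≃ K R-sym R-simulation)
       (related (s≤s (ℕ.m≤m⊔n (maxName M) (maxName N)))
                (s≤s (ℕ.m≤n⊔m (maxName M) (maxName N))) r)
  where
  K : ℕ
  K = suc (maxName M ⊔ maxName N)

-- Normal forms and multiplicities

count : Term → List Term → ℕ
count c = length ∘ filter (≃-dec c)

infix 4 _≐_
_≐_ : List Term → List Term → Set
L ≐ L′ = ∀ c → count c L ≡ count c L′

count-++ : ∀ c L L′ → count c (L ++ L′) ≡ count c L + count c L′
count-++ c L L′ =
  ≡.trans (cong length (filter-++ (≃-dec c) L L′)) (length-++ (filter (≃-dec c) L))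

≐-↭ : ∀ {L L′} → L ↭ L′ → L ≐ L′
≐-↭ L↭L′ c = ↭-length (filter-↭ (≃-dec c) L↭L′)

count-∷-≃ : ∀ {c e} L → c ≃ e → count c (e ∷ L) ≡ suc (count c L)
count-∷-≃ L c≃e = cong length (filter-accept (≃-dec _) c≃e)

count-∷-≄ : ∀ {c e} L → ¬ c ≃ e → count c (e ∷ L) ≡ count c L
count-∷-≄ L c≄e = cong length (filter-reject (≃-dec _) c≄e)

count-∷-cong : ∀ c {e e′} L → e ≃ e′ → count c (e ∷ L) ≡ count c (e′ ∷ L)
count-∷-cong c L e≃e′ with ≃-dec c _
... | yes c≃e = ≡.trans (count-∷-≃ L c≃e) (≡.sym (count-∷-≃ L (≃-trans c≃e e≃e′)))
... | no c≄e  = ≡.trans (count-∷-≄ L c≄e) (≡.sym (count-∷-≄ L c≄e′))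
  where
  c≄e′ = λ c≃e′ → c≄e (≃-trans c≃e′ (≃-sym e≃e′))

count-∷-suc⇒≃ : ∀ {c e} L → count c (e ∷ L) ≡ suc (count c L) → c ≃ e
count-∷-suc⇒≃ {c} {e} L eq with ≃-dec c e
... | yes c≃e = c≃e
... | no c≄e  = ⊥-elim (ℕ.1+n≢n (≡.trans (≡.sym eq) (count-∷-≄ L c≄e)))

∈⇒count-pos : ∀ {c L} → c ∈ L → 0 < count c L
∈⇒count-pos c∈L = filter-some (≃-dec _) (lose c∈L ≃-refl)

count-pos⇒∈ : ∀ {c L} → 0 < count c L → ∃ λ e → e ∈ L × c ≃ e
count-pos⇒∈ {c} {L} pos with filter (≃-dec c) L in eq
... | e ∷ _ = e , ∈-filter⁻ (≃-dec c) (≡.subst (e ∈_) (≡.sym eq) (here ≡.refl))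

∈⇒factor : ∀ {e : Term} {L} → e ∈ L → ∃ λ R → L ↭ e ∷ R
∈⇒factor {e} e∈L with xs , ys , ≡.refl ← ∈-∃++ e∈L = xs ++ ys , shift e xs ys

count-pos⇒factor : ∀ {c L} → 0 < count c L → ∃₂ λ e R → L ↭ e ∷ R × c ≃ e
count-pos⇒factor {c} {L} pos =
  let e , e∈L , c≃e = count-pos⇒∈ {c} {L} pos
      R , L↭ = ∈⇒factor e∈L
  in e , R , L↭ , c≃e

count-smaller : ∀ {c L} → All (λ e → size e < size c) L → count c L ≡ 0
count-smaller smaller =
  cong length (filter-none (≃-dec _) (All.map (λ e<c c≃e → ℕ.<-irrefl (≡.sym (≃-size c≃e)) e<c)
                                             smaller))

-- η • Π K is an instance of the left-hand side of (D_{j+1}), up to ≃, with η • R a factor of K.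
DWitness : Prefix → List Term → Term → Set
DWitness η K c = ∃₂ λ R j → c ≡ η • R × Π K ≃ R ∥ powS (η • R) j

DForm : Prefix → List Term → Set
DForm η K = Any (DWitness η K) K

data Component : Term → Set where
  var : ∀ x → Component (var x)
  pre : ∀ η {K} → All Component K → ¬ DForm η K → Component (η • Π K)

Normal : List Term → Set
Normal = All Component

obsOf : ∀ {c} → Component c → Obs
obsOf (var x)     = varᵒ x
obsOf (pre η _ _) = preᵒ η

body : ∀ {c} → Component c → List Term
body (var x)         = []
body (pre η {K} _ _) = K

body-normal : ∀ {c} (n : Component c) → Normal (body n)
body-normal (var x)      = []
body-normal (pre η nK _) = nK

component-step : ∀ {c} (n : Component c) → c ⟶[ obs (obsOf n) ] Π (body n)
component-step (var x)     = varₜ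
component-step (pre η _ _) = preₜ

component-step⁻ : ∀ {c o c′} (n : Component c) → c ⟶[ obs o ] c′ →
                  o ≡ obsOf n × c′ ≡ Π (body n)
component-step⁻ (var x)     varₜ = ≡.refl , ≡.refl
component-step⁻ (pre η _ _) preₜ = ≡.refl , ≡.refl

component-≃ : ∀ {c c′} (n : Component c) (m : Component c′) → c ≃ c′ →
              obsOf n ≡ obsOf m × Π (body n) ≃ Π (body m)
component-≃ n m c≃c′ with _ , u , r ← ≃-transfer c≃c′ (component-step n)
                     with o≡ , ≡.refl ← component-step⁻ m u = o≡ , r

≈ᴰ-size : ∀ {M N} → M ≈ᴰ N → size M ≡ size N
≈ᴰ-size = ≃-size ∘ ≈ᴰ⇒≃

size-∈ : ∀ {c L} → c ∈ L → size c ≤ size (Π L)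
size-∈ {L = c ∷ L} (here ≡.refl) = ℕ.m≤m+n (size c) (size (Π L))
size-∈ {L = e ∷ L} (there c∈L)   = ℕ.≤-trans (size-∈ c∈L) (ℕ.m≤n+m (size (Π L)) (size e))

Bounded : ℕ → List Term → Set
Bounded s = All (λ e → size e ≤ s)

Bounded-weaken : ∀ {s s′ L} → s ≤ s′ → Bounded s L → Bounded s′ L
Bounded-weaken s≤s′ = All.map (λ e≤s → ℕ.≤-trans e≤s s≤s′)

Bounded-Π : ∀ L → Bounded (size (Π L)) L
Bounded-Π L = All.tabulate size-∈

size-component : ∀ {c} (n : Component c) → size c ≡ suc (size (Π (body n)))
size-component n = size-step (component-step n)

body-smaller : ∀ {c} (n : Component c) → All (λ e → size e < size c) (body n)
body-smaller n = All.tabulate λ e∈ → ≡.subst (_ <_) (≡.sym (size-component n)) (s≤s (size-∈ e∈))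

Π-step⁻ : ∀ {L o X} → Normal L → Π L ⟶[ obs o ] X →
          ∃₂ λ c R → Σ (Component c) λ n → L ↭ c ∷ R × o ≡ obsOf n × X ≃ Π (body n ++ R)
Π-step⁻ {c ∷ L} (n ∷ _) (parLₜ t) with ≡.refl , ≡.refl ← component-step⁻ n t =
  c , L , n , ↭-refl , ≡.refl , ≈ᴰ⇒≃ (sym (Π-++ (body n) L))
Π-step⁻ {e ∷ L} (_ ∷ nL) (parRₜ t) with c , R , n , L↭ , ≡.refl , X≃ ← Π-step⁻ nL t =
  c , e ∷ R , n , ↭-trans (↭-prep e L↭) (↭-swap e c ↭-refl) , ≡.refl ,
  ≃-trans (≃-∥ ≃-refl X≃) (≈ᴰ⇒≃ (Π-↭ (↭-sym (shift e (body n) R))))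

Π-fire : ∀ {L c R} → L ↭ c ∷ R → (n : Component c) →
         ∃ λ X → Π L ⟶[ obs (obsOf n) ] X × X ≃ Π (body n ++ R)
Π-fire {R = R} L↭ n
  with X , t , X≃ ← ≃-transfer⁻ (≈ᴰ⇒≃ (Π-↭ L↭)) (parLₜ (component-step n)) =
  X , t , ≃-trans X≃ (≈ᴰ⇒≃ (sym (Π-++ (body n) R)))

Π-match : ∀ {L L′ c R} → Normal L′ → Π L ≃ Π L′ → L ↭ c ∷ R → (n : Component c) →
          ∃₂ λ q R′ → Σ (Component q) λ m →
            L′ ↭ q ∷ R′ × obsOf n ≡ obsOf m × Π (body n ++ R) ≃ Π (body m ++ R′)
Π-match nL′ L≃L′ L↭ n
  with X , t , X≃ ← Π-fire L↭ n
  with Y , u , X≃Y ← ≃-transfer L≃L′ t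
  with q , R′ , m , L′↭ , o≡ , Y≃ ← Π-step⁻ nL′ u =
  q , R′ , m , L′↭ , o≡ , ≃-trans (≃-sym X≃) (≃-trans X≃Y Y≃)

j<size-powS : ∀ η R j → j < size (powS (η • R) j)
j<size-powS η R zero    = s≤s z≤n
j<size-powS η R (suc j) = s≤s (ℕ.≤-trans (j<size-powS η R j) (ℕ.m≤n+m _ (size R)))

DWitness-dec : ∀ η K c → Dec (DWitness η K c)
DWitness-dec η K 𝟎ₜ      = no λ { (_ , _ , () , _) }
DWitness-dec η K (_ ∥ _) = no λ { (_ , _ , () , _) }
DWitness-dec η K (var _) = no λ { (_ , _ , () , _) }
DWitness-dec η K (η′ • R) with η′ ≟ᵖ η
... | no η′≢η    = no λ { (_ , _ , ≡.refl , _) → η′≢η ≡.refl }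
... | yes ≡.refl = map′ (λ (j , _ , K≃) → R , j , ≡.refl , K≃)
                        (λ { (_ , j , ≡.refl , K≃) → j , bound j K≃ , K≃ })
                        (ℕ.anyUpTo? (λ j → ≃-dec (Π K) (R ∥ powS (η • R) j)) (size (Π K)))
  where
  bound : ∀ j → Π K ≃ R ∥ powS (η • R) j → j < size (Π K)
  bound j K≃ =
    ≡.subst (j <_) (≡.sym (≃-size K≃)) (ℕ.≤-trans (j<size-powS η R j) (ℕ.m≤n+m _ (size R)))

DForm-dec : ∀ η K → Dec (DForm η K)
DForm-dec η K = any? (DWitness-dec η K) K

powS-replicate : ∀ c j → powS c j ≈ᴰ Π (replicate (suc j) c)
powS-replicate c zero    = sym (∥-identityʳ c)
powS-replicate c (suc j) = cpar refl (powS-replicate c j)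

CompleteBelow : ℕ → Set
CompleteBelow n = ∀ {M N} → size M < n → M ≃ N → M ≈ᴰ N

normalise : ∀ {n} → CompleteBelow n → ∀ M → size M ≤ n → ∃ λ L → Normal L × M ≈ᴰ Π L
normalise complete 𝟎ₜ      _ = [] , [] , refl
normalise complete (var x) _ = [ var x ] , var x ∷ [] , sym (∥-identityʳ (var x))
normalise complete (A ∥ B) A∥B≤n =
  let LA , nA , A≈ = normalise complete A (ℕ.≤-trans (ℕ.m≤m+n (size A) (size B)) A∥B≤n)
      LB , nB , B≈ = normalise complete B (ℕ.≤-trans (ℕ.m≤n+m (size B) (size A)) A∥B≤n)
  in LA ++ LB , ++⁺ nA nB , trans (cpar A≈ B≈) (sym (Π-++ LA LB))
normalise {n} complete (η • A) A<n
  with K , nK , A≈ ← normalise complete A (ℕ.<⇒≤ A<n)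
  with DForm-dec η K
... | no ¬D = [ η • Π K ] , pre η nK ¬D ∷ [] , trans (cpre η A≈) (sym (∥-identityʳ _))
... | yes dForm with c , c∈K , R , j , ≡.refl , K≃ ← find dForm =
  replicate (suc (suc j)) (η • R) , replicate⁺ (suc (suc j)) (All.lookup nK c∈K) , (begin
    η • A                          ≈⟨ cpre η A≈ ⟩
    η • Π K                        ≈⟨ cpre η (complete (≡.subst (_< n) (≈ᴰ-size A≈) A<n) K≃) ⟩
    η • (R ∥ powS (η • R) j)       ≈⟨ D-law j η R ⟩
    powS (η • R) (suc j)           ≈⟨ powS-replicate (η • R) (suc j) ⟩
    Π (replicate (suc (suc j)) (η • R)) ∎)
  where open ≈ᴰ-Reasoning

≐-∷ : ∀ {c c′ L R} → c ≃ c′ → L ≐ R → c ∷ L ≐ c′ ∷ R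
≐-∷ {c} {c′} {L} {R} c≃c′ L≐R d = begin
  count d (c ∷ L)              ≡⟨ count-∷-cong d L c≃c′ ⟩
  count d (c′ ∷ L)             ≡⟨ count-++ d [ c′ ] L ⟩
  count d [ c′ ] + count d L   ≡⟨ cong (count d [ c′ ] +_) (L≐R d) ⟩
  count d [ c′ ] + count d R   ≡⟨ count-++ d [ c′ ] R ⟨
  count d (c′ ∷ R)             ∎
  where open ≡.≡-Reasoning

≐-cancel : ∀ {c c′ L R} → c ≃ c′ → c ∷ L ≐ c′ ∷ R → L ≐ R
≐-cancel {c} {c′} {L} {R} c≃c′ cL≐c′R d =
  ℕ.+-cancelˡ-≡ (count d [ c′ ]) (count d L) (count d R) (begin
  count d [ c′ ] + count d L   ≡⟨ count-++ d [ c′ ] L ⟨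
  count d (c′ ∷ L)             ≡⟨ count-∷-cong d L c≃c′ ⟨
  count d (c ∷ L)              ≡⟨ cL≐c′R d ⟩
  count d (c′ ∷ R)             ≡⟨ count-++ d [ c′ ] R ⟩
  count d [ c′ ] + count d R   ∎)
  where open ≡.≡-Reasoning

component-≈ᴰ : ∀ {n c c′} → CompleteBelow n → Component c → Component c′ → size c ≤ n →
               c ≃ c′ → c ≈ᴰ c′
component-≈ᴰ complete nc nc′ c≤n c≃c′ with component-≃ nc nc′ c≃c′
component-≈ᴰ complete (var x)     (var .x)     _   _ | ≡.refl , _ = refl
component-≈ᴰ complete (pre η _ _) (pre .η _ _) c≤n _ | ≡.refl , K≃K′ = cpre η (complete c≤n K≃K′)

≐⇒≈ᴰ : ∀ {n L L′} → CompleteBelow n → Normal L → Normal L′ → Bounded n L → L ≐ L′ →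
       Π L ≈ᴰ Π L′
≐⇒≈ᴰ {L = []} {[]} _ _ _ _ _ = refl
≐⇒≈ᴰ {L = []} {e ∷ L′} _ _ _ _ L≐L′ with () ← ≡.trans (L≐L′ e) (count-∷-≃ {e} L′ ≃-refl)
≐⇒≈ᴰ {L = c ∷ L} {L′} complete (nc ∷ nL) nL′ (c≤n ∷ L≤n) L≐L′
  with c′ , R , L′↭ , c≃c′ ← count-pos⇒factor {c} {L′}
         (≡.subst (0 <_) (L≐L′ c) (∈⇒count-pos {c} {c ∷ L} (here ≡.refl)))
  with nc′ ∷ nR ← All-resp-↭ L′↭ nL′ = begin
    c ∥ Π L    ≈⟨ cpar (component-≈ᴰ complete nc nc′ c≤n c≃c′)
                       (≐⇒≈ᴰ complete nL nR L≤n L≐R) ⟩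
    c′ ∥ Π R   ≈⟨ Π-↭ (↭-sym L′↭) ⟩
    Π L′       ∎
  where
  open ≈ᴰ-Reasoning
  L≐R : L ≐ R
  L≐R = ≐-cancel c≃c′ λ d → ≡.trans (L≐L′ d) (≐-↭ L′↭ d)

-- Unique decomposition

size-fire : ∀ {L c R} → L ↭ c ∷ R → (n : Component c) → size (Π L) ≡ suc (size (Π (body n ++ R)))
size-fire L↭ n with X , t , X≃ ← Π-fire L↭ n = ≡.trans (size-step t) (cong suc (≃-size X≃))

fired-normal : ∀ {L c R} → Normal L → L ↭ c ∷ R → (n : Component c) → Normal (body n ++ R)
fired-normal nL L↭ n with _ ∷ nR ← All-resp-↭ L↭ nL = ++⁺ (body-normal n) nR

fired-bounded : ∀ {s L c R} → Bounded s L → L ↭ c ∷ R → (n : Component c) →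
                Bounded s (body n ++ R)
fired-bounded bL L↭ n with c≤s ∷ bR ← All-resp-↭ L↭ bL =
  ++⁺ (All.map (λ e<c → ℕ.<⇒≤ (ℕ.<-≤-trans e<c c≤s)) (body-smaller n)) bR

component-pos : ∀ {c} → Component c → 0 < size c
component-pos nc = ≡.subst (0 <_) (≡.sym (size-component nc)) (s≤s z≤n)

size-pos : ∀ {c L} → Normal (c ∷ L) → 0 < size (Π (c ∷ L))
size-pos {c} {L} (nc ∷ _) = ℕ.<-≤-trans (component-pos nc) (ℕ.m≤m+n (size c) (size (Π L)))

count-smaller-++ : ∀ {c} B R → All (λ e → size e < size c) B → count c (B ++ R) ≡ count c R
count-smaller-++ {c} B R smaller =
  ≡.trans (count-++ c B R) (cong (_+ count c R) (count-smaller smaller))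

≐-factor : ∀ {c L B R} → L ≐ B ++ R → c ∈ L → All (λ e → size e < size c) B →
           ∃₂ λ c′ R′ → R ↭ c′ ∷ R′ × c ≃ c′
≐-factor {c} {L} {B} {R} L≐BR c∈L smaller = count-pos⇒factor {c} {R}
  (≡.subst (0 <_) (≡.trans (L≐BR c) (count-smaller-++ B R smaller)) (∈⇒count-pos c∈L))

≐-occurs : ∀ {c K B r R} → K ≐ B ++ r ∷ R → All (λ e → size e < size c) B → c ≃ r →
           ∃ λ e → e ∈ K × c ≃ e
≐-occurs {c} {K} {B} {r} {R} K≐ smaller c≃r =
  count-pos⇒∈ {c} {K} (≡.subst (0 <_) (≡.sym count-c) (s≤s z≤n))
  where
  count-c : count c K ≡ suc (count c R)
  count-c = ≡.trans (K≐ c) (≡.trans (count-smaller-++ B (r ∷ R) smaller) (count-∷-≃ R c≃r))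

Π-++-congˡ : ∀ K K′ L → Π K ≃ Π K′ → Π (K ++ L) ≃ Π (K′ ++ L)
Π-++-congˡ K K′ L K≃K′ =
  ≃-trans (≈ᴰ⇒≃ (Π-++ K L)) (≃-trans (≃-∥ K≃K′ ≃-refl) (≈ᴰ⇒≃ (sym (Π-++ K′ L))))

max-factor : ∀ c L → ∃₂ λ p R → c ∷ L ↭ p ∷ R × Bounded (size p) (c ∷ L)
max-factor c [] = c , [] , ↭-refl , ℕ.≤-refl ∷ []
max-factor c (d ∷ L)
  with p , R , dL↭ , bounded ← max-factor d L
  with ℕ.≤-total (size c) (size p)
... | inj₁ c≤p = p , c ∷ R , ↭-trans (↭-prep c dL↭) (↭-swap c p ↭-refl) , c≤p ∷ bounded
... | inj₂ p≤c = c , d ∷ L , ↭-refl , ℕ.≤-refl ∷ Bounded-weaken p≤c bounded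

Π-≃-powS : ∀ {c r} rest → All (_≃ c) (r ∷ rest) → Π (r ∷ rest) ≃ powS c (length rest)
Π-≃-powS []         (r≃c ∷ [])     = ≃-trans (≈ᴰ⇒≃ (∥-identityʳ _)) r≃c
Π-≃-powS (_ ∷ rest) (r≃c ∷ rest≃c) = ≃-∥ r≃c (Π-≃-powS rest rest≃c)

-- Count the copies of q in K: the body of a factor no larger than q contains none.
copies-of-max : ∀ {K q R} (nq : Component q) → Normal R → Bounded (size q) R → K ≐ body nq ++ R →
                (∀ {r R′} → R ↭ r ∷ R′ → (nr : Component r) → K ≐ body nr ++ q ∷ R′) →
                All (q ≃_) R
copies-of-max {K} {q} {R} nq nR bR K≐ K≐′ = All.tabulate λ {r} r∈R →
  let R′ , R↭ = ∈⇒factor r∈R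
      nr = All.lookup nR r∈R
      body-r<q = All.map (λ e<r → ℕ.<-≤-trans e<r (All.lookup bR r∈R)) (body-smaller nr)
  in count-∷-suc⇒≃ R′ (begin
    count q (r ∷ R′)               ≡⟨ ≐-↭ R↭ q ⟨
    count q R                      ≡⟨ count-smaller-++ (body nq) R (body-smaller nq) ⟨
    count q (body nq ++ R)         ≡⟨ K≐ q ⟨
    count q K                      ≡⟨ K≐′ R↭ nr q ⟩
    count q (body nr ++ q ∷ R′)    ≡⟨ count-smaller-++ (body nr) (q ∷ R′) body-r<q ⟩
    count q (q ∷ R′)               ≡⟨ count-∷-≃ R′ ≃-refl ⟩
    suc (count q R′)               ∎)
  where open ≡.≡-Reasoning

UniqueBelow : ℕ → Set
UniqueBelow f = ∀ {L L′} → Normal L → Normal L′ → size (Π L) < f → Π L ≃ Π L′ → L ≐ L′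

module Decomposition {f} (unique : UniqueBelow f) where

  module Cancellation {p} (np : Component p) where

    record Cancellable (A B : List Term) : Set where
      constructor cancellable
      field
        normal-A  : Normal A
        normal-B  : Normal B
        bounded-A : Bounded (size p) A
        bounded-B : Bounded (size p) B
        small     : size (Π (p ∷ A)) ≤ f
        equiv     : Π (p ∷ A) ≃ Π (p ∷ B)

    cancellable-sym : ∀ {A B} → Cancellable A B → Cancellable B A
    cancellable-sym (cancellable nA nB bA bB small eq) =
      cancellable nB nA bB bA (≡.subst (_≤ f) (≃-size eq) small) (≃-sym eq)

    CancelRel : Term → Term → Set
    CancelRel X Y = ∃₂ λ A B → X ≡ Π A × Y ≡ Π B × Cancellable A B

    cancelRel-sym : ∀ {X Y} → CancelRel X Y → CancelRel Y X
    cancelRel-sym (A , B , X≡ , Y≡ , c) = B , A , Y≡ , X≡ , cancellable-sym c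

    fired-smaller : ∀ {A a A₀} → A ↭ a ∷ A₀ → (na : Component a) →
                    size (Π (p ∷ body na ++ A₀)) < size (Π (p ∷ A))
    fired-smaller A↭ na = ℕ.+-monoʳ-< (size p) (ℕ.≤-reflexive (≡.sym (size-fire A↭ na)))

    fired : ∀ {A B a A₀ b B₀} → Cancellable A B →
            A ↭ a ∷ A₀ → (na : Component a) → B ↭ b ∷ B₀ → (nb : Component b) →
            Π (p ∷ body na ++ A₀) ≃ Π (p ∷ body nb ++ B₀) →
            CancelRel (Π (body na ++ A₀)) (Π (body nb ++ B₀))
    fired (cancellable nA nB bA bB small _) A↭ na B↭ nb equiv′ = _ , _ , ≡.refl , ≡.refl ,
      cancellable (fired-normal nA A↭ na) (fired-normal nB B↭ nb)
                  (fired-bounded bA A↭ na) (fired-bounded bB B↭ nb)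
                  (ℕ.<⇒≤ (ℕ.<-≤-trans (fired-smaller A↭ na) small)) equiv′

    answered-by-B : ∀ {A B a A₀ X o Y} → Cancellable A B → A ↭ a ∷ A₀ → (na : Component a) →
                    X ≃ Π (body na ++ A₀) → Π B ⟶[ obs o ] Y → p ∥ X ≃ p ∥ Y → UpTo≃ CancelRel X Y
    answered-by-B c@(cancellable _ nB _ _ _ _) A↭ na X≃ u pX≃pY
      with b , B₀ , nb , B↭ , _ , Y≃ ← Π-step⁻ nB u =
      _ , _ , X≃ , fired c A↭ na B↭ nb equiv′ , ≃-sym Y≃
      where
      open SetoidReasoning ≃-setoid
      equiv′ : Π (p ∷ body na ++ _) ≃ Π (p ∷ body nb ++ B₀)
      equiv′ = begin
        p ∥ Π (body na ++ _)    ≈⟨ ≃-∥ ≃-refl (≃-sym X≃) ⟩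
        p ∥ _                   ≈⟨ pX≃pY ⟩
        p ∥ _                   ≈⟨ ≃-∥ ≃-refl Y≃ ⟩
        p ∥ Π (body nb ++ B₀)   ∎

    -- p's own step is handed over to a factor b ≃ p of B, which exists by unique decomposition
    -- of the smaller residuals.
    answered-by-p : ∀ {A B a A₀ X} → Cancellable A B → A ↭ a ∷ A₀ → (na : Component a) →
                    X ≃ Π (body na ++ A₀) → p ∥ X ≃ Π (body np) ∥ Π B →
                    ∃ λ Y → Π B ⟶[ obs (obsOf np) ] Y × UpTo≃ CancelRel X Y
    answered-by-p {B = B} c@(cancellable nA nB _ _ small _) A↭ na X≃ pX≃
      with pA′≃ ← ≃-trans (≃-trans (≃-∥ ≃-refl (≃-sym X≃)) pX≃) (≈ᴰ⇒≃ (sym (Π-++ (body np) B)))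
      with b , B₀ , B↭ , p≃b ← ≐-factor
             (unique (np ∷ fired-normal nA A↭ na) (++⁺ (body-normal np) nB)
                     (ℕ.<-≤-trans (fired-smaller A↭ na) small) pA′≃)
             (here ≡.refl) (body-smaller np)
      with nb ∷ _ ← All-resp-↭ B↭ nB
      with obs≡ , body≃ ← component-≃ np nb p≃b
      with Y , u , Y≃ ← Π-fire B↭ nb =
      Y , ≡.subst (λ o → Π B ⟶[ obs o ] Y) (≡.sym obs≡) u ,
      _ , _ , X≃ , fired c A↭ na B↭ nb equiv′ , ≃-sym Y≃
      where
      open SetoidReasoning ≃-setoid
      B↭′ : body nb ++ B ↭ b ∷ body nb ++ B₀
      B↭′ = ↭-trans (++⁺ˡ (body nb) B↭) (shift b (body nb) B₀)
      equiv′ : Π (p ∷ body na ++ _) ≃ Π (p ∷ body nb ++ B₀)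
      equiv′ = begin
        p ∥ Π (body na ++ _)      ≈⟨ pA′≃ ⟩
        Π (body np ++ B)          ≈⟨ Π-++-congˡ (body np) (body nb) B body≃ ⟩
        Π (body nb ++ B)          ≈⟨ ≈ᴰ⇒≃ (Π-↭ B↭′) ⟩
        b ∥ Π (body nb ++ B₀)     ≈⟨ ≃-∥ (≃-sym p≃b) ≃-refl ⟩
        p ∥ Π (body nb ++ B₀)     ∎

    cancel-transfer : ∀ {A B} → Cancellable A B → Transfer (UpTo≃ CancelRel) (Π A) (Π B)
    cancel-transfer c@(cancellable nA _ _ _ _ equiv) t
      with a , A₀ , na , A↭ , ≡.refl , X≃ ← Π-step⁻ nA t
      with _ , u , pX≃ ← ≃-transfer equiv (parRₜ {M = p} t)
      with u
    ... | parRₜ u′ = _ , u′ , answered-by-B c A↭ na X≃ u′ pX≃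
    ... | parLₜ u′
      with o≡ , ≡.refl ← component-step⁻ np u′
      with Y , u″ , upTo ← answered-by-p c A↭ na X≃ pX≃ =
      Y , ≡.subst (λ o → _ ⟶[ obs o ] Y) (≡.sym o≡) u″ , upTo

    cancel : ∀ {A B} → Cancellable A B → Π A ≃ Π B
    cancel c = bisimulationUpTo≃⊆≃ isBisimulation (_ , _ , ≡.refl , ≡.refl , c)
      where
      isBisimulation : IsBisimulationUpTo≃ CancelRel
      isBisimulation (_ , _ , ≡.refl , ≡.refl , c) =
        cancel-transfer c ,
        Transfer-map (UpTo≃-sym cancelRel-sym) (cancel-transfer (cancellable-sym c))

  open Cancellation using (cancellable; cancel)

  single-match : ∀ {p L′ r R} (np : Component p) → Π [ p ] ≃ Π L′ → L′ ↭ r ∷ R →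
                 (nr : Component r) → obsOf nr ≡ obsOf np × Π (body np) ≃ Π (body nr ++ R)
  single-match np p≃L′ L′↭ nr
    with X , t , X≃ ← Π-fire L′↭ nr
    with _ , parLₜ u , Z≃X ← ≃-transfer⁻ p≃L′ t
    with o≡ , ≡.refl ← component-step⁻ np u =
    o≡ , ≃-trans (≈ᴰ⇒≃ (sym (∥-identityʳ _))) (≃-trans Z≃X X≃)

  single-match-≐ : ∀ {p L′ r R} (np : Component p) → size p ≤ f → Normal L′ → Π [ p ] ≃ Π L′ →
                   L′ ↭ r ∷ R → (nr : Component r) → body np ≐ body nr ++ R
  single-match-≐ np p≤f nL′ p≃L′ L′↭ nr =
    unique (body-normal np) (fired-normal nL′ L′↭ nr) (≡.subst (_≤ f) (size-component np) p≤f)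
           (proj₂ (single-match np p≃L′ L′↭ nr))

  not-dform : ∀ {p q c j} (np : Component p) (nq : Component q) → obsOf nq ≡ obsOf np →
              c ∈ body np → q ≃ c → Π (body np) ≃ Π (body nq) ∥ powS c j → ⊥
  not-dform (pre η nK ¬dForm) nq q-obs c∈K q≃c K≃ with All.lookup nK c∈K
  ... | var x with () ← ≡.trans (≡.sym q-obs) (proj₁ (component-≃ nq (var x) q≃c))
  ... | pre η′ nKc ¬dForm′
    with c-obs , body≃ ← component-≃ nq (pre η′ nKc ¬dForm′) q≃c
    with ≡.refl ← ≡.trans (≡.sym c-obs) q-obs =
    ¬dForm (lose c∈K (_ , _ , ≡.refl , ≃-trans K≃ (≃-∥ body≃ ≃-refl)))

  indecomposable-max : ∀ {p L′ q r₀ rest} → Component p → Normal L′ → Bounded (size q) L′ →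
                       L′ ↭ q ∷ r₀ ∷ rest → size p ≤ f → Π [ p ] ≃ Π L′ → ⊥
  indecomposable-max {L′ = L′} {q} {r₀} {rest} np nL′ bL′ L′↭ p≤f p≃L′
    with nq ∷ nR ← All-resp-↭ L′↭ nL′
    with _ ∷ bR ← All-resp-↭ L′↭ bL′
    with q-obs , K≃ ← single-match np p≃L′ L′↭ nq
    with K≐ ← single-match-≐ np p≤f nL′ p≃L′ L′↭ nq
    with q≃r₀ ∷ q≃rest ← copies-of-max {body np} nq nR bR K≐ (λ {r} R↭ nr →
           single-match-≐ np p≤f nL′ p≃L′
             (↭-trans L′↭ (↭-trans (↭-prep q R↭) (↭-swap q r ↭-refl))) nr)
    with c , c∈K , q≃c ← ≐-occurs {q} {body np} {body nq} K≐ (body-smaller nq) q≃r₀ =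
    not-dform np nq q-obs c∈K q≃c (begin
      Π (body np)                           ≈⟨ K≃ ⟩
      Π (body nq ++ r₀ ∷ rest)              ≈⟨ ≈ᴰ⇒≃ (Π-++ (body nq) (r₀ ∷ rest)) ⟩
      Π (body nq) ∥ Π (r₀ ∷ rest)           ≈⟨ ≃-∥ ≃-refl (Π-≃-powS rest rest≃c) ⟩
      Π (body nq) ∥ powS _ (length rest)    ∎)
    where
    open SetoidReasoning ≃-setoid
    rest≃c = All.map (λ q≃r → ≃-trans (≃-sym q≃r) q≃c) (q≃r₀ ∷ q≃rest)

  indecomposable : ∀ {p q₁ q₂ L″} → Component p → Normal (q₁ ∷ q₂ ∷ L″) → size p ≤ f →
                   Π [ p ] ≃ Π (q₁ ∷ q₂ ∷ L″) → ⊥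
  indecomposable {q₁ = q₁} {q₂} {L″} np nL′ p≤f p≃L′ with max-factor q₁ (q₂ ∷ L″)
  ... | _ , []    , L′↭ , _   with () ← ↭-length L′↭
  ... | _ , _ ∷ _ , L′↭ , bL′ = indecomposable-max np nL′ bL′ L′↭ p≤f p≃L′

  unique-with-max : ∀ {p L₀ L′} → Component p → Normal L₀ → Normal L′ →
                    Bounded (size p) L₀ → Bounded (size p) L′ →
                    size (Π (p ∷ L₀)) ≤ f → Π (p ∷ L₀) ≃ Π L′ → p ∷ L₀ ≐ L′
  unique-with-max {L₀ = []} {[]} np _ _ _ _ _ p≃L′ =
    ⊥-elim (ℕ.<-irrefl (≡.sym (≃-size p≃L′)) (size-pos (np ∷ [])))
  unique-with-max {p} {[]} {q ∷ []} np _ _ _ _ _ p≃L′ =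
    ≐-∷ (≃-trans (≈ᴰ⇒≃ (sym (∥-identityʳ p))) (≃-trans p≃L′ (≈ᴰ⇒≃ (∥-identityʳ q))))
        (λ _ → ≡.refl)
  unique-with-max {p} {[]} {_ ∷ _ ∷ _} np _ nL′ _ _ p≤f p≃L′ =
    ⊥-elim (indecomposable np nL′ (≡.subst (_≤ f) (ℕ.+-identityʳ (size p)) p≤f) p≃L′)
  unique-with-max {p} {e ∷ L₁} {L′} np nL₀@(ne ∷ _) nL′ bL₀ bL′ small p≃L′
    with q , R′ , nq , L′↭ , _ , fired≃ ← Π-match nL′ p≃L′ (↭-swap p e ↭-refl) ne
    with q≤p ∷ _ ← All-resp-↭ L′↭ bL′
    with p′ , L′₁ , R′↭ , p≃p′ ← ≐-factor {p} {body ne ++ p ∷ L₁} {body nq} {R′}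
           (unique (fired-normal (np ∷ nL₀) (↭-swap p e ↭-refl) ne) (fired-normal nL′ L′↭ nq)
                   (≡.subst (_≤ f) (size-fire (↭-swap p e ↭-refl) ne) small) fired≃)
           (∈-++⁺ʳ (body ne) (here ≡.refl))
           (All.map (λ e<q → ℕ.<-≤-trans e<q q≤p) (body-smaller nq))
    with L′↭′ ← ↭-trans L′↭ (↭-trans (↭-prep q R′↭) (↭-swap q p′ ↭-refl))
    with _ ∷ nq ∷ nL′₁ ← All-resp-↭ L′↭′ nL′
    with _ ∷ bq ∷ bL′₁ ← All-resp-↭ L′↭′ bL′ =
    λ d → ≡.trans (≐-∷ p≃p′ L₀≐ d) (≐-↭ (↭-sym L′↭′) d)
    where
    L₀≐ : e ∷ L₁ ≐ q ∷ L′₁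
    L₀≐ = unique nL₀ (nq ∷ nL′₁) (ℕ.<-≤-trans (ℕ.m<n+m _ (component-pos np)) small)
            (cancel np (cancellable nL₀ (nq ∷ nL′₁) bL₀ (bq ∷ bL′₁) small
              (≃-trans p≃L′ (≃-trans (≈ᴰ⇒≃ (Π-↭ L′↭′)) (≃-∥ (≃-sym p≃p′) ≃-refl)))))

  unique-oriented : ∀ {p R L L′} → L ↭ p ∷ R → Normal L → Normal L′ →
                    Bounded (size p) L → Bounded (size p) L′ →
                    size (Π L) < suc f → Π L ≃ Π L′ → L ≐ L′
  unique-oriented {p} {R} L↭ nL nL′ bL bL′ L<1+f L≃L′
    with np ∷ nR ← All-resp-↭ L↭ nL
    with _ ∷ bR ← All-resp-↭ L↭ bL = λ d → ≡.trans (≐-↭ L↭ d)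
      (unique-with-max np nR nL′ bR bL′ (≡.subst (_≤ f) (≈ᴰ-size (Π-↭ L↭)) (ℕ.≤-pred L<1+f))
                       (≃-trans (≈ᴰ⇒≃ (sym (Π-↭ L↭))) L≃L′) d)

  unique-suc : UniqueBelow (suc f)
  unique-suc {[]}    {[]}     _  _   _ _    _ = ≡.refl
  unique-suc {[]}    {_ ∷ _}  _  nL′ _ L≃L′ = ⊥-elim (ℕ.<-irrefl (≃-size L≃L′) (size-pos nL′))
  unique-suc {_ ∷ _} {[]}     nL _   _ L≃L′ = ⊥-elim (ℕ.<-irrefl (≡.sym (≃-size L≃L′)) (size-pos nL))
  unique-suc {c ∷ L} {c′ ∷ L′} nL nL′ L<1+f L≃L′
    with p , _ , L↭ , bL ← max-factor c L
    with p′ , _ , L′↭ , bL′ ← max-factor c′ L′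
    with ℕ.≤-total (size p′) (size p)
  ... | inj₁ p′≤p = unique-oriented L↭ nL nL′ bL (Bounded-weaken p′≤p bL′) L<1+f L≃L′
  ... | inj₂ p≤p′ = λ d → ≡.sym (unique-oriented L′↭ nL′ nL bL′ (Bounded-weaken p≤p′ bL)
                                   (≡.subst (_< suc f) (≃-size L≃L′) L<1+f) (≃-sym L≃L′) d)

unique-decomposition : ∀ f → UniqueBelow f
unique-decomposition zero    _ _ () _
unique-decomposition (suc f) = Decomposition.unique-suc (unique-decomposition f)

-- Completeness

complete-suc : ∀ {n} → CompleteBelow n → CompleteBelow (suc n)
complete-suc {n} complete {M} {N} M<1+n M≃N =
  let L , nL , M≈L = normalise complete M (ℕ.≤-pred M<1+n)
      L′ , nL′ , N≈L′ = normalise complete N (≡.subst (_≤ n) (≃-size M≃N) (ℕ.≤-pred M<1+n))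
      L≤n = ≡.subst (_≤ n) (≈ᴰ-size M≈L) (ℕ.≤-pred M<1+n)
      L≃L′ = ≃-trans (≃-sym (≈ᴰ⇒≃ M≈L)) (≃-trans M≃N (≈ᴰ⇒≃ N≈L′))
      L≐L′ = unique-decomposition (suc n) nL nL′ (s≤s L≤n) L≃L′
  in trans M≈L (trans (≐⇒≈ᴰ complete nL nL′ (Bounded-weaken L≤n (Bounded-Π L)) L≐L′) (sym N≈L′))

complete-below : ∀ n → CompleteBelow n
complete-below zero    ()
complete-below (suc n) = complete-suc (complete-below n)

≃⇒≈ᴰ : ∀ {M N} → M ≃ N → M ≈ᴰ N
≃⇒≈ᴰ {M} = complete-below (suc (size M)) (ℕ.n<1+n (size M))

theorem3p6 : (M N : Term) → (ExtEq M N → Axiom ⊢ M ≈ N) × (Axiom ⊢ M ≈ N → ExtEq M N)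
theorem3p6 M N = ≃⇒≈ᴰ ∘ extEq⇒≃ , soundness
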